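{- For every permutation $\pi$ of $\{1,\dots,n\}$, $\operatorname{bc}^1(\pi)=n-\operatorname{lis}(\pi)$.
   Context: A block move $(i,j,k)$ with $1\le i\le j<k\le n$ maps $[\dots\pi_{i-1}\,\pi_i\dots\pi_j\,\pi_{j+1}\dots\pi_k\,\pi_{k+1}\dots]$ to $[\dots\pi_{i-1}\,\pi_{j+1}\dots\pi_k\,\pi_i\dots\pi_j\,\pi_{k+1}\dots]$; it is monotone if $\pi_q>\pi_r$ for all $i\le q\le j<r\le k$. $\operatorname{bc}^1(\pi)$ is the minimum number of monotone block moves of the form $(i,i,k)$ or $(i,k-1,k)$ (i.e., at least one of the two exchanged blocks has a single element) needed to transform $\pi$ into the identity permutation. $\operatorname{lis}(\pi)$ is the length of a longest increasing subsequence of $\pi$. -}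

module Defs where

open import Data.Nat using (ℕ; zero; suc; _<_; _≤_; _≡ᵇ_)
open import Data.List using (List; []; _∷_; _++_; length; applyUpTo)
open import Data.List.Relation.Unary.All using (All)
open import Data.List.Relation.Unary.Linked using (Linked)
open import Data.List.Relation.Binary.Sublist.Propositional using (_⊆_)
open import Data.List.Relation.Binary.Permutation.Propositional using (_↭_)
open import Data.Product using (Σ; _×_; ∃)
open import Data.Sum using (_⊎_)
open import Data.Empty using (⊥)
open import Relation.Binary.PropositionalEquality using (_≡_)

identity : ℕ → List ℕ
identity n = applyUpTo suc n

IsPerm : ℕ → List ℕ → Set
IsPerm n π = π ↭ identity n

-- A block move (i,j,k), 1 ≤ i ≤ j < k ≤ n, on π = a ++ b ++ c ++ d with
-- a = π₁…π_{i-1}, b = π_i…π_j (nonempty), c = π_{j+1}…π_k (nonempty):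
-- result a ++ c ++ b ++ d.  Restricted form (i,i,k) or (i,k-1,k): |b| = 1 or |c| = 1.
data MonoStep1 : List ℕ → List ℕ → Set where
  move : (a b c d : List ℕ) →
         1 ≤ length b → 1 ≤ length c →
         (length b ≡ 1 ⊎ length c ≡ 1) →
         All (λ x → All (λ y → y < x) c) b →
         MonoStep1 (a ++ b ++ c ++ d) (a ++ c ++ b ++ d)

data Steps : ℕ → List ℕ → List ℕ → Set where
  done : ∀ {σ} → Steps zero σ σ
  step : ∀ {m σ σ′ τ} → MonoStep1 σ σ′ → Steps m σ′ τ → Steps (suc m) σ τ

IsBC1 : ℕ → List ℕ → ℕ → Set
IsBC1 n π k = Steps k π (identity n) × (∀ m → m < k → Steps m π (identity n) → ⊥)

IncSub : List ℕ → List ℕ → Set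
IncSub s π = (s ⊆ π) × Linked _<_ s

IsLIS : List ℕ → ℕ → Set
IsLIS π L = (Σ (List ℕ) λ s → IncSub s π × length s ≡ L)
          × (∀ s → IncSub s π → length s ≤ L)

-- Each move displaces a single element, so undoing a move costs an increasing
-- subsequence at most one element; hence bc¹(π) ≥ n − lis(π).
-- Conversely, let s be an increasing subsequence of π with |s| < n. If some
-- q ∈ s is not below everything after it, take the leftmost such q and the
-- minimum x of the entries after q: moving x in front of q is monotone and puts
-- x into s. Symmetrically (on the reversed permutation) if some q ∈ s is not
-- above everything before it. Otherwise every entry outside s can be added to s
-- where it stands. So each move lengthens s by one, and bc¹(π) ≤ n − lis(π).
module Submission where

open import Defs
open import Data.Nat using (ℕ; zero; suc; _∸_; _+_; _<_; _≤_; z≤n; s≤s)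
import Data.Nat.Properties as ℕₚ
open import Data.Nat.Properties
  using (<-isStrictTotalOrder; ≤-totalOrder; <⇒≤; <-irrefl; <⇒≱; ≤-antisym; ≤-refl; n≤1+n; m≤n⇒m≤1+n;
         +-suc; +-identityʳ; +-comm; +-monoʳ-≤; m<m+n; m≤n+o⇒m∸n≤o; m+[n∸m]≡n; module ≤-Reasoning)
open import Data.List using (List; []; _∷_; _++_; [_]; length; reverse)
open import Data.List.Properties
  using (++-assoc; reverse-++; unfold-reverse; reverse-involutive; length-reverse; length-applyUpTo; ∷-injectiveʳ)
open import Data.List.Membership.Propositional using (_∈_; _∉_)
open import Data.List.Membership.Propositional.Properties using (∈-insert; ∈-∃++)
open import Data.List.Relation.Unary.All as All using (All; []; _∷_; all?)
open import Data.List.Relation.Unary.All.Properties as All using ()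
open import Data.List.Relation.Unary.Any using (here; there)
open import Data.List.Relation.Unary.Any.Properties as Any using ()
open import Data.List.Relation.Unary.AllPairs as AllPairs using (AllPairs; []; _∷_)
open import Data.List.Relation.Unary.AllPairs.Properties as AllPairs using (applyUpTo⁺₁)
open import Data.List.Relation.Unary.Linked as Linked using (Linked)
open import Data.List.Relation.Unary.Linked.Properties using (AllPairs⇒Linked; Linked⇒AllPairs)
open import Data.List.Relation.Unary.Unique.Propositional using (Unique)
open import Data.List.Relation.Unary.Unique.Propositional.Properties using (Unique[x∷xs]⇒x∉xs)
open import Data.List.Relation.Unary.Sorted.TotalOrder.Properties using (↗↭↗⇒≋)
open import Data.List.Relation.Binary.Equality.Propositional using (≋⇒≡)
open import Data.List.Relation.Binary.Sublist.Propositional using (_⊆_; []; _∷_; _∷ʳ_; ⊆-refl; ⊆-trans)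
open import Data.List.Relation.Binary.Sublist.Propositional.Properties as Sublist
  using (All-resp-⊆; Any-resp-⊆; to-≋)
open import Data.List.Relation.Binary.Permutation.Propositional using (_↭_; ↭-sym; ↭-trans; ↭⇒↭ₛ)
open import Data.List.Relation.Binary.Permutation.Propositional.Properties
  using (All-resp-↭; ↭-length; ↭-reverse; shifts; ++⁺ˡ)
open import Data.List.Relation.Binary.Permutation.Setoid.Properties using (Unique-resp-↭)
open import Data.Product using (∃; ∃₂; _×_; _,_)
open import Data.Sum using (_⊎_; inj₁; inj₂)
open import Data.Empty using (⊥-elim)
open import Function using (flip)
open import Level using (Level; _⊔_)
open import Relation.Nullary using (¬_; yes; no)
open import Relation.Binary.Core using (Rel)
open import Relation.Binary.Structures using (IsStrictTotalOrder)
open import Relation.Binary.Definitions using (tri<; tri≈; tri>)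
import Relation.Binary.Construct.Flip.EqAndOrd as Flip
open import Relation.Binary.PropositionalEquality
  using (_≡_; refl; sym; trans; cong; subst; subst₂; setoid; module ≡-Reasoning)

private
  variable
    a ℓ : Level
    A : Set a
    R : Rel A ℓ
    v : A
    xs ys zs : List A

reverse-++⁴ : (as bs cs ds : List A) →
              reverse (as ++ bs ++ cs ++ ds) ≡ reverse ds ++ reverse cs ++ reverse bs ++ reverse as
reverse-++⁴ as bs cs ds = begin
  reverse (as ++ bs ++ cs ++ ds)
    ≡⟨ reverse-++ as (bs ++ cs ++ ds) ⟩
  reverse (bs ++ cs ++ ds) ++ reverse as
    ≡⟨ cong (_++ reverse as) (reverse-++ bs (cs ++ ds)) ⟩
  (reverse (cs ++ ds) ++ reverse bs) ++ reverse as
    ≡⟨ cong (λ l → (l ++ reverse bs) ++ reverse as) (reverse-++ cs ds) ⟩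
  ((reverse ds ++ reverse cs) ++ reverse bs) ++ reverse as
    ≡⟨ ++-assoc (reverse ds ++ reverse cs) (reverse bs) (reverse as) ⟩
  (reverse ds ++ reverse cs) ++ reverse bs ++ reverse as
    ≡⟨ ++-assoc (reverse ds) (reverse cs) (reverse bs ++ reverse as) ⟩
  reverse ds ++ reverse cs ++ reverse bs ++ reverse as
    ∎
  where open ≡-Reasoning

AllPairs-reverse⁺ : AllPairs R xs → AllPairs (flip R) (reverse xs)
AllPairs-reverse⁺ {xs = []} [] = []
AllPairs-reverse⁺ {R = R} {xs = y ∷ xs} (Rx ∷ Rxs) =
  subst (AllPairs (flip R)) (sym (unfold-reverse y xs))
    (AllPairs.++⁺ (AllPairs-reverse⁺ Rxs) ([] ∷ [])
                  (All-resp-↭ (↭-sym (↭-reverse xs)) (All.map (_∷ []) Rx)))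

AllPairs-resp-⊇ : xs ⊆ ys → AllPairs R ys → AllPairs R xs
AllPairs-resp-⊇ []             Rys        = Rys
AllPairs-resp-⊇ (_ ∷ʳ xs⊆ys)   (_ ∷ Rys)  = AllPairs-resp-⊇ xs⊆ys Rys
AllPairs-resp-⊇ (refl ∷ xs⊆ys) (Ry ∷ Rys) = All-resp-⊆ xs⊆ys Ry ∷ AllPairs-resp-⊇ xs⊆ys Rys

⊆-delete-∉ : ∀ ys → v ∉ xs → xs ⊆ ys ++ v ∷ zs → xs ⊆ ys ++ zs
⊆-delete-∉ []       v∉xs (_ ∷ʳ xs⊆zs) = xs⊆zs
⊆-delete-∉ []       v∉xs (refl ∷ _)   = ⊥-elim (v∉xs (here refl))
⊆-delete-∉ (y ∷ ys) v∉xs (.y ∷ʳ xs⊆)  = y ∷ʳ ⊆-delete-∉ ys v∉xs xs⊆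
⊆-delete-∉ (y ∷ ys) v∉xs (refl ∷ xs⊆) = refl ∷ ⊆-delete-∉ ys (λ v∈ → v∉xs (there v∈)) xs⊆

⊆-delete : ∀ ys → xs ⊆ ys ++ v ∷ zs →
           ∃ λ xs′ → xs′ ⊆ ys ++ zs × xs′ ⊆ xs × length xs ≤ suc (length xs′)
⊆-delete []       (_ ∷ʳ xs⊆zs)   = _ , xs⊆zs , ⊆-refl , n≤1+n _
⊆-delete []       (refl ∷ xs⊆zs) = _ , xs⊆zs , (_ ∷ʳ ⊆-refl) , ≤-refl
⊆-delete (y ∷ ys) (.y ∷ʳ xs⊆)    with xs′ , xs′⊆ , xs′⊆xs , len ← ⊆-delete ys xs⊆ =
  xs′ , y ∷ʳ xs′⊆ , xs′⊆xs , len
⊆-delete (y ∷ ys) (refl ∷ xs⊆)   with xs′ , xs′⊆ , xs′⊆xs , len ← ⊆-delete ys xs⊆ =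
  y ∷ xs′ , refl ∷ xs′⊆ , refl ∷ xs′⊆xs , s≤s len

swap-blocks-↭ : (as bs cs ds : List A) → as ++ bs ++ cs ++ ds ↭ as ++ cs ++ bs ++ ds
swap-blocks-↭ as bs cs ds = ++⁺ˡ as (shifts bs cs)

module Insertion {A : Set a} {_<_ : Rel A ℓ} (isStrictTotalOrder : IsStrictTotalOrder _≡_ _<_) where

  open IsStrictTotalOrder isStrictTotalOrder using (asym; compare; _<?_) renaming (trans to <-trans)

  Longer : List A → List A → Set (a ⊔ ℓ)
  Longer s σ = ∃ λ s′ → s′ ⊆ σ × AllPairs _<_ s′ × length s′ ≡ suc (length s)

  RightToLeftMinima : List A → List A → Set (a ⊔ ℓ)
  RightToLeftMinima s π = ∀ {q} → q ∈ s → ∀ ys zs → π ≡ ys ++ q ∷ zs → All (q <_) zs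

  record LeftInsertion (s π : List A) : Set (a ⊔ ℓ) where
    field
      before block after : List A
      x                  : A
      split              : π ≡ before ++ block ++ x ∷ after
      block-nonempty     : 1 ≤ length block
      x<block            : All (x <_) block
      longer             : Longer s (before ++ x ∷ block ++ after)

  minimum-split : ∀ {y ys} → Unique (y ∷ ys) →
    ∃₂ λ us m → ∃ λ vs → y ∷ ys ≡ us ++ m ∷ vs × All (m <_) us × All (m <_) vs
  minimum-split {y = y} {ys = []} _ = [] , y , [] , refl , [] , []
  minimum-split {y = y} {ys = _ ∷ _} u@(_ ∷ u′) with minimum-split u′
  ... | us , m , vs , eq , m<us , m<vs with compare y m
  ... | tri< y<m _ _ = [] , y , _ , refl , [] ,
          subst (All (y <_)) (sym eq)
            (All.++⁺ (All.map (<-trans y<m) m<us) (y<m ∷ All.map (<-trans y<m) m<vs))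
  ... | tri≈ _ refl _ = ⊥-elim (Unique[x∷xs]⇒x∉xs u (subst (y ∈_) (sym eq) (∈-insert us)))
  ... | tri> _ _ m<y = y ∷ us , m , vs , cong (y ∷_) eq , m<y ∷ m<us , m<vs

  minima-skip : ∀ {m s π} → m ∉ π → s ⊆ π → RightToLeftMinima s π → RightToLeftMinima s (m ∷ π)
  minima-skip m∉π s⊆π _      q∈s []       zs refl = ⊥-elim (m∉π (Any-resp-⊆ s⊆π q∈s))
  minima-skip _   _   minima q∈s (_ ∷ ys) zs eq   = minima q∈s ys zs (∷-injectiveʳ eq)

  minima-keep : ∀ {m s π} → m ∉ π → All (m <_) π →
                RightToLeftMinima s π → RightToLeftMinima (m ∷ s) (m ∷ π)
  minima-keep _   m<π _      _            []       _  refl = m<π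
  minima-keep m∉π _   _      (here refl)  (_ ∷ ys) zs eq   =
    ⊥-elim (m∉π (subst (_ ∈_) (sym (∷-injectiveʳ eq)) (∈-insert ys)))
  minima-keep _   _   minima (there q∈s)  (_ ∷ ys) zs eq   = minima q∈s ys zs (∷-injectiveʳ eq)

  insertion-skip : ∀ {s π} m → LeftInsertion s π → LeftInsertion s (m ∷ π)
  insertion-skip m ins = record
    { before = m ∷ before ; block = block ; after = after ; x = x
    ; split = cong (m ∷_) split ; block-nonempty = block-nonempty ; x<block = x<block
    ; longer = let s′ , s′⊆ , s′↑ , len = longer in s′ , m ∷ʳ s′⊆ , s′↑ , len
    }
    where open LeftInsertion ins

  insertion-keep : ∀ {s π m} → All (m <_) π → LeftInsertion s π → LeftInsertion (m ∷ s) (m ∷ π)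
  insertion-keep {m = m} m<π ins = record
    { before = m ∷ before ; block = block ; after = after ; x = x
    ; split = cong (m ∷_) split ; block-nonempty = block-nonempty ; x<block = x<block
    ; longer = let s′ , s′⊆ , s′↑ , len = longer
               in m ∷ s′ , refl ∷ s′⊆ , m<s′ s′⊆ ∷ s′↑ , cong suc len
    }
    where
      open LeftInsertion ins
      m<s′ : ∀ {s′} → s′ ⊆ before ++ x ∷ block ++ after → All (m <_) s′
      m<s′ s′⊆ = All-resp-⊆ s′⊆
        (All-resp-↭ (swap-blocks-↭ before block [ x ] after) (subst (All (m <_)) split m<π))

  insert-minimum : ∀ {m s π} → Unique (m ∷ π) → All (m <_) s → AllPairs _<_ s → s ⊆ π →
                   ¬ All (m <_) π → LeftInsertion (m ∷ s) (m ∷ π)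
  insert-minimum {π = []} _ _ _ _ m≮π = ⊥-elim (m≮π [])
  insert-minimum {m = m} {s = s} {π = _ ∷ _} u@(_ ∷ π!) m<s s↑ s⊆π m≮π
    with us , x , vs , π≡ , x<us , x<vs ← minimum-split π! = record
    { before = [] ; block = m ∷ us ; after = vs ; x = x
    ; split = cong (m ∷_) π≡ ; block-nonempty = s≤s z≤n ; x<block = x<m ∷ x<us
    ; longer = x ∷ m ∷ s , refl ∷ refl ∷ ⊆-delete-∉ us x∉s (subst (s ⊆_) π≡ s⊆π) ,
               (x<m ∷ All.map (<-trans x<m) m<s) ∷ m<s ∷ s↑ , refl
    }
    where
      x<m : x < m
      x<m with compare x m
      ... | tri< x<m _ _ = x<m
      ... | tri≈ _ refl _ = ⊥-elim (Unique[x∷xs]⇒x∉xs u (subst (x ∈_) (sym π≡) (∈-insert us)))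
      ... | tri> _ _ m<x  = ⊥-elim (m≮π (subst (All (m <_)) (sym π≡)
                              (All.++⁺ (All.map (<-trans m<x) x<us) (m<x ∷ All.map (<-trans m<x) x<vs))))
      x∉s : x ∉ s
      x∉s x∈s = asym x<m (All.lookup m<s x∈s)

  insertion⊎minima : ∀ {s π} → s ⊆ π → AllPairs _<_ s → Unique π →
                     LeftInsertion s π ⊎ RightToLeftMinima s π
  insertion⊎minima [] _ _ = inj₂ λ ()
  insertion⊎minima (m ∷ʳ s⊆π) s↑ u@(_ ∷ π!) with insertion⊎minima s⊆π s↑ π!
  ... | inj₁ ins    = inj₁ (insertion-skip m ins)
  ... | inj₂ minima = inj₂ (minima-skip (Unique[x∷xs]⇒x∉xs u) s⊆π minima)
  insertion⊎minima {π = m ∷ π} (refl ∷ s⊆π) (m<s ∷ s↑) u@(_ ∷ π!) with all? (m <?_) π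
  ... | no m≮π = inj₁ (insert-minimum u m<s s↑ s⊆π m≮π)
  ... | yes m<π with insertion⊎minima s⊆π s↑ π!
  ...   | inj₁ ins    = inj₁ (insertion-keep m<π ins)
  ...   | inj₂ minima = inj₂ (minima-keep (Unique[x∷xs]⇒x∉xs u) m<π minima)

-- The mirror case is the left case for the reversed list and the reversed order.
module <-Insertion = Insertion <-isStrictTotalOrder
module >-Insertion = Insertion (Flip.isStrictTotalOrder <-isStrictTotalOrder)
open <-Insertion using (Longer; RightToLeftMinima; LeftInsertion; insertion⊎minima)

LeftToRightMaxima : List ℕ → List ℕ → Set
LeftToRightMaxima s π = ∀ {q} → q ∈ s → ∀ ys zs → π ≡ ys ++ q ∷ zs → All (_< q) ys

reversed-minima : ∀ {s π} → >-Insertion.RightToLeftMinima (reverse s) (reverse π) → LeftToRightMaxima s π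
reversed-minima minima {q} q∈s ys zs refl =
  All-resp-↭ (↭-reverse ys)
    (minima (Any.reverse⁺ q∈s) (reverse zs) (reverse ys) (reverse-++⁴ ys [] [ q ] zs))

reversed-longer : ∀ {s σ} → >-Insertion.Longer (reverse s) σ → Longer s (reverse σ)
reversed-longer {s} (s′ , s′⊆σ , s′↓ , len) =
  reverse s′ , Sublist.reverse⁺ s′⊆σ , AllPairs-reverse⁺ s′↓ ,
  trans (length-reverse s′) (trans len (cong suc (length-reverse s)))

extend-in-place : ∀ {s π} → s ⊆ π → AllPairs _<_ s → RightToLeftMinima s π → LeftToRightMaxima s π →
                  length s < length π → Longer s π
extend-in-place {s} (m ∷ʳ s⊆π) s↑ _ maxima _ = m ∷ s , refl ∷ s⊆π , m<s ∷ s↑ , refl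
  where
    m<s : All (m <_) s
    m<s = All.tabulate λ q∈s →
      let ys , zs , π≡ = ∈-∃++ (Any-resp-⊆ s⊆π q∈s) in All.head (maxima q∈s (m ∷ ys) zs (cong (m ∷_) π≡))
extend-in-place {m ∷ s} (refl ∷ s⊆π) (_ ∷ s↑) minima maxima (s≤s |s|<|π|) =
  let s′ , s′⊆π , s′↑ , len = extend-in-place s⊆π s↑ minima-tail maxima-tail |s|<|π|
  in m ∷ s′ , refl ∷ s′⊆π , All-resp-⊆ s′⊆π (minima (here refl) [] _ refl) ∷ s′↑ , cong suc len
  where
    minima-tail : RightToLeftMinima s _
    minima-tail q∈s ys zs π≡ = minima (there q∈s) (m ∷ ys) zs (cong (m ∷_) π≡)
    maxima-tail : LeftToRightMaxima s _
    maxima-tail q∈s ys zs π≡ = All.tail (maxima (there q∈s) (m ∷ ys) zs (cong (m ∷_) π≡))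

move-left : ∀ {s π} → LeftInsertion s π → ∃ λ π′ → MonoStep1 π π′ × Longer s π′
move-left record { before = as ; block = bs ; after = cs ; x = x ; split = refl
                 ; block-nonempty = bs≢[] ; x<block = x<bs ; longer = longer } =
  as ++ x ∷ bs ++ cs , move as bs [ x ] cs bs≢[] (s≤s z≤n) (inj₂ refl) (All.map (_∷ []) x<bs) , longer

move-right : ∀ {s π} → >-Insertion.LeftInsertion (reverse s) (reverse π) →
             ∃ λ π′ → MonoStep1 π π′ × Longer s π′
move-right {s} {π} record { before = as ; block = bs ; after = cs ; x = x ; split = split
                          ; block-nonempty = bs≢[] ; x<block = bs<x ; longer = longer } =
  reverse (as ++ x ∷ bs ++ cs) ,
  subst₂ MonoStep1 (sym π≡) (sym (reverse-++⁴ as [ x ] bs cs)) x-right ,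
  reversed-longer {s} longer
  where
    π≡ : π ≡ reverse cs ++ x ∷ reverse bs ++ reverse as
    π≡ = begin
      π                                 ≡⟨ reverse-involutive π ⟨
      reverse (reverse π)               ≡⟨ cong reverse split ⟩
      reverse (as ++ bs ++ x ∷ cs)      ≡⟨ reverse-++⁴ as bs [ x ] cs ⟩
      reverse cs ++ x ∷ reverse bs ++ reverse as ∎
      where open ≡-Reasoning
    x-right : MonoStep1 (reverse cs ++ [ x ] ++ reverse bs ++ reverse as)
                        (reverse cs ++ reverse bs ++ [ x ] ++ reverse as)
    x-right = move (reverse cs) [ x ] (reverse bs) (reverse as) (s≤s z≤n)
             (subst (1 ≤_) (sym (length-reverse bs)) bs≢[]) (inj₁ refl)
             (All-resp-↭ (↭-sym (↭-reverse bs)) bs<x ∷ [])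

Unique-reverse : Unique xs → Unique (reverse xs)
Unique-reverse {xs = xs} = Unique-resp-↭ (setoid _) (↭⇒↭ₛ (↭-sym (↭-reverse xs)))

insertion-step : ∀ {s π} → Unique π → s ⊆ π → AllPairs _<_ s → length s < length π →
                 Longer s π ⊎ ∃ λ π′ → MonoStep1 π π′ × Longer s π′
insertion-step {s} π! s⊆π s↑ |s|<|π| with insertion⊎minima s⊆π s↑ π!
... | inj₁ ins = inj₂ (move-left ins)
... | inj₂ minima
  with >-Insertion.insertion⊎minima (Sublist.reverse⁺ s⊆π) (AllPairs-reverse⁺ s↑) (Unique-reverse π!)
...   | inj₁ ins     = inj₂ (move-right {s} ins)
...   | inj₂ minima′ = inj₁ (extend-in-place s⊆π s↑ minima (reversed-minima minima′) |s|<|π|)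

identity-increasing : ∀ n → AllPairs _<_ (identity n)
identity-increasing n = applyUpTo⁺₁ suc n (λ i<j _ → s≤s i<j)

perm-length : ∀ {n π} → IsPerm n π → length π ≡ n
perm-length {n} π↭ = trans (↭-length π↭) (length-applyUpTo suc n)

perm-unique : ∀ {n π} → IsPerm n π → Unique π
perm-unique {n} π↭ = Unique-resp-↭ (setoid ℕ) (↭⇒↭ₛ (↭-sym π↭))
  (AllPairs.map (λ i<j i≡j → <-irrefl i≡j i<j) (identity-increasing n))

increasing-perm : ∀ {n π} → IsPerm n π → AllPairs _<_ π → π ≡ identity n
increasing-perm {n} π↭ π↑ =
  ≋⇒≡ (↗↭↗⇒≋ ≤-totalOrder (sorted π↑) (sorted (identity-increasing n)) (↭⇒↭ₛ π↭))
  where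
    sorted : ∀ {xs} → AllPairs _<_ xs → Linked _≤_ xs
    sorted xs↑ = Linked.map <⇒≤ (AllPairs⇒Linked xs↑)

moved-perm : ∀ {σ σ′} → MonoStep1 σ σ′ → σ′ ↭ σ
moved-perm (move as bs cs ds _ _ _ _) = swap-blocks-↭ as cs bs ds

sort-within : ∀ k {n π s} → IsPerm n π → s ⊆ π → AllPairs _<_ s → length s + k ≡ n →
              ∃ λ m → m ≤ k × Steps m π (identity n)
sort-within zero {n} {π} {s} π↭ s⊆π s↑ |s|≡n =
  0 , z≤n , subst (λ σ → Steps 0 σ (identity n)) (sym π≡id) done
  where
    s≡π : s ≡ π
    s≡π = ≋⇒≡ (to-≋ (trans (trans (sym (+-identityʳ _)) |s|≡n) (sym (perm-length π↭))) s⊆π)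
    π≡id : π ≡ identity n
    π≡id = increasing-perm π↭ (subst (AllPairs _<_) s≡π s↑)
sort-within (suc k) {n} {π} {s} π↭ s⊆π s↑ |s|+k≡n =
  continue (insertion-step (perm-unique π↭) s⊆π s↑ |s|<|π|)
  where
    |s|<|π| : length s < length π
    |s|<|π| = subst (length s <_) (trans |s|+k≡n (sym (perm-length π↭))) (m<m+n (length s) (s≤s z≤n))
    |s′|+k≡n : ∀ (s′ : List ℕ) → length s′ ≡ suc (length s) → length s′ + k ≡ n
    |s′|+k≡n _ len = trans (cong (_+ k) len) (trans (sym (+-suc (length s) k)) |s|+k≡n)
    continue : Longer s π ⊎ (∃ λ π′ → MonoStep1 π π′ × Longer s π′) →
               ∃ λ m → m ≤ suc k × Steps m π (identity n)
    continue (inj₁ (s′ , s′⊆π , s′↑ , len)) =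
      let m , m≤k , steps = sort-within k π↭ s′⊆π s′↑ (|s′|+k≡n s′ len) in m , m≤n⇒m≤1+n m≤k , steps
    continue (inj₂ (π′ , π→π′ , s′ , s′⊆π′ , s′↑ , len)) =
      let m , m≤k , steps = sort-within k (↭-trans (moved-perm π→π′) π↭) s′⊆π′ s′↑ (|s′|+k≡n s′ len)
      in suc m , s≤s m≤k , step π→π′ steps

unmove : ∀ {σ σ′ s} → MonoStep1 σ σ′ → s ⊆ σ′ → AllPairs _<_ s →
         ∃ λ s′ → s′ ⊆ σ × AllPairs _<_ s′ × length s ≤ suc (length s′)
unmove (move as bs (c ∷ []) ds _ _ _ _) s⊆ s↑ =
  let s′ , s′⊆ , s′⊆s , len = ⊆-delete as s⊆
  in s′ , ⊆-trans s′⊆ (Sublist.++⁺ (⊆-refl {x = as}) (Sublist.++⁺ (⊆-refl {x = bs}) (c ∷ʳ ⊆-refl))) ,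
     AllPairs-resp-⊇ s′⊆s s↑ , len
unmove {s = s} (move as (b ∷ []) cs ds _ _ _ _) s⊆ s↑ =
  let s′ , s′⊆ , s′⊆s , len = ⊆-delete (as ++ cs) (subst (s ⊆_) (sym (++-assoc as cs (b ∷ ds))) s⊆)
  in s′ , ⊆-trans (subst (s′ ⊆_) (++-assoc as cs ds) s′⊆) (Sublist.++⁺ (⊆-refl {x = as}) (b ∷ʳ ⊆-refl)) ,
     AllPairs-resp-⊇ s′⊆s s↑ , len
unmove (move _ []          _           _ () _ _ _) _ _
unmove (move _ _           []          _ _ () _ _) _ _
unmove (move _ (_ ∷ _ ∷ _) (_ ∷ _ ∷ _) _ _ _ (inj₁ ()) _) _ _
unmove (move _ (_ ∷ _ ∷ _) (_ ∷ _ ∷ _) _ _ _ (inj₂ ()) _) _ _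

unmoves : ∀ {m σ τ s} → Steps m σ τ → s ⊆ τ → AllPairs _<_ s →
          ∃ λ s′ → s′ ⊆ σ × AllPairs _<_ s′ × length s ≤ m + length s′
unmoves done s⊆ s↑ = _ , s⊆ , s↑ , ≤-refl
unmoves {suc m} {s = s} (step σ→σ′ steps) s⊆τ s↑ =
  let s₁ , s₁⊆σ′ , s₁↑ , |s|≤ = unmoves steps s⊆τ s↑
      s₂ , s₂⊆σ , s₂↑ , |s₁|≤ = unmove σ→σ′ s₁⊆σ′ s₁↑
  in s₂ , s₂⊆σ , s₂↑ , (begin
    length s               ≤⟨ |s|≤ ⟩
    m + length s₁          ≤⟨ +-monoʳ-≤ m |s₁|≤ ⟩
    m + suc (length s₂)    ≡⟨ +-suc m (length s₂) ⟩
    suc m + length s₂      ∎)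
  where open ≤-Reasoning

n∸lis≤moves : ∀ {n π L m} → IsLIS π L → Steps m π (identity n) → n ∸ L ≤ m
n∸lis≤moves {n} {L = L} {m} (_ , lis-maximal) steps =
  let s′ , s′⊆π , s′↑ , n≤m+|s′| = unmoves steps ⊆-refl (identity-increasing n)
  in m≤n+o⇒m∸n≤o n L (begin
    n                    ≡⟨ length-applyUpTo suc n ⟨
    length (identity n)  ≤⟨ n≤m+|s′| ⟩
    m + length s′        ≤⟨ +-monoʳ-≤ m (lis-maximal s′ (s′⊆π , AllPairs⇒Linked s′↑)) ⟩
    m + L                ≡⟨ +-comm m L ⟩
    L + m                ∎)
  where open ≤-Reasoning

lemma3 : (n : ℕ) (π : List ℕ) → IsPerm n π → (L : ℕ) → IsLIS π L → IsBC1 n π (n ∸ L)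
lemma3 n π π↭ L lis@((s , (s⊆π , s↗) , refl) , _)
  with m , m≤n∸L , steps ← sort-within (n ∸ L) π↭ s⊆π (Linked⇒AllPairs ℕₚ.<-trans s↗)
                              (m+[n∸m]≡n (subst (L ≤_) (perm-length π↭) (Sublist.length-mono-≤ s⊆π)))
  = subst (λ k → Steps k π (identity n)) (≤-antisym m≤n∸L (n∸lis≤moves lis steps)) steps
  , λ m′ m′<n∸L steps′ → <⇒≱ m′<n∸L (n∸lis≤moves lis steps′)
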